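{- For all $x,y,u,v\in\mathbb{C}$ and all integers $n\ge 0$, $$(x\oplus_{ -u,-v}y)_{s,t}^{(2n)}=(-1)^{n}(x\ominus_{u,v}y)_{s,t}^{(2n)},\qquad (x\oplus_{ -u,-v}y)_{s,t}^{(2n+1)}=(-1)^{n}(x\oplus_{u,v}y)_{s,t}^{(2n+1)}.$$
   Context: Let $s,t$ be nonzero complex numbers. The Lucas sequence is defined by $\{0\}_{s,t}=0$, $\{1\}_{s,t}=1$, $\{n+2\}_{s,t}=s\{n+1\}_{s,t}+t\{n\}_{s,t}$; it is assumed that $\{n\}_{s,t}\neq0$ for $n\ge1$. Put $\{n\}_{s,t}!=\{1\}_{s,t}\cdots\{n\}_{s,t}$ (with $\{0\}_{s,t}!=1$) and $\genfrac{\{}{\}}{0pt}{}{n}{k}_{s,t}=\frac{\{n\}_{s,t}!}{\{k\}_{s,t}!\{n-k\}_{s,t}!}$ for $0\le k\le n$. For $u,v,x,y\in\mathbb{C}$ and $n\ge0$ define $(x\oplus_{u,v}y)_{s,t}^{(n)}=\sum_{k=0}^{n}\genfrac{\{}{\}}{0pt}{}{n}{k}_{s,t}u^{\binom{n-k}{2}}v^{\binom{k}{2}}x^{n-k}y^{k}$ (with the convention $0^0=1$) and $(x\ominus_{u,v}y)_{s,t}^{(n)}=(x\oplus_{u,v}(-y))_{s,t}^{(n)}$. -}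

module Defs where

open import Level using (_⊔_)
open import Algebra.Bundles using (CommutativeRing)
open import Data.Nat as ℕ using (ℕ; zero; suc; _∸_)
open import Data.Nat.Combinatorics using (_C_)
open import Relation.Nullary using (¬_)

-- A field: a commutative ring with 0 ≉ 1 and a (total) inverse function
-- which is a genuine inverse on every nonzero element.
-- (ℂ is an instance, with 0⁻¹ chosen arbitrarily.)
record Field (c ℓ : Level.Level) : Set (Level.suc (c ⊔ ℓ)) where
  field
    commutativeRing : CommutativeRing c ℓ
  open CommutativeRing commutativeRing public
  field
    _⁻¹      : Carrier → Carrier
    0≉1      : ¬ (0# ≈ 1#)
    ⁻¹-inverseʳ : ∀ x → ¬ (x ≈ 0#) → (x * (x ⁻¹)) ≈ 1#

module FieldDefs {c ℓ} (F : Field c ℓ) where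
  open Field F hiding (zero)

  _^_ : Carrier → ℕ → Carrier
  x ^ zero  = 1#
  x ^ suc n = x * (x ^ n)

  choose2 : ℕ → ℕ
  choose2 m = m C 2

  module Lucas (s t : Carrier) where
    lucas : ℕ → Carrier
    lucas zero = 0#
    lucas (suc zero) = 1#
    lucas (suc (suc n)) = (s * lucas (suc n)) + (t * lucas n)

    lucasFact : ℕ → Carrier
    lucasFact zero = 1#
    lucasFact (suc n) = lucasFact n * lucas (suc n)

    lucasNomial : ℕ → ℕ → Carrier
    lucasNomial n k = lucasFact n * ((lucasFact k * lucasFact (n ∸ k)) ⁻¹)

    term : Carrier → Carrier → Carrier → Carrier → ℕ → ℕ → Carrier
    term u v x y n k =
      lucasNomial n k * ((u ^ choose2 (n ∸ k)) * ((v ^ choose2 k) * ((x ^ (n ∸ k)) * (y ^ k))))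

    sumUpTo : (ℕ → Carrier) → ℕ → Carrier
    sumUpTo f zero = f zero
    sumUpTo f (suc m) = sumUpTo f m + f (suc m)

    oplus : Carrier → Carrier → Carrier → Carrier → ℕ → Carrier
    oplus u v x y n = sumUpTo (term u v x y n) n

    ominus : Carrier → Carrier → Carrier → Carrier → ℕ → Carrier
    ominus u v x y n = oplus u v x (- y) n

-- Replacing (u, v) by (-u, -v) multiplies the k-th term of the length-N sum by
-- (-1)^(C(N-k,2) + C(k,2)), and C(N-k,2) + C(k,2) = C(N,2) - k(N-k).  For N = 2n this
-- is n + k mod 2, and the factor (-1)^k is absorbed by replacing y with -y; for
-- N = 2n+1 it is n mod 2, since one of k, N-k is even.
module Submission where

open import Defs
open import Level using (Level)
open import Data.Nat as ℕ using (ℕ; suc)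
open import Data.Product using (_×_)
open import Relation.Nullary using (¬_)

module Choose2 where
  open import Data.Nat using (zero; _+_; _*_)
  open import Data.Nat.Properties using (+-identityʳ; +-comm; *-distribʳ-+)
  open import Data.Nat.Combinatorics using (_C_; nC1≡n; nCk+nC[k+1]≡[n+1]C[k+1])
  open import Data.Nat.Tactic.RingSolver using (solve-∀)
  open import Relation.Binary.PropositionalEquality as ≡ using (_≡_; cong; cong₂)

  infix 4 _≡[mod2]_
  data _≡[mod2]_ (a b : ℕ) : Set where
    mod2 : ∀ p q → a + 2 * p ≡ b + 2 * q → a ≡[mod2] b

  [1+m]C2≡m+mC2 : ∀ m → suc m C 2 ≡ m + m C 2
  [1+m]C2≡m+mC2 m = ≡.trans (≡.sym (nCk+nC[k+1]≡[n+1]C[k+1] m 1)) (cong (_+ m C 2) (nC1≡n m))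

  [m+n]C2≡mC2+nC2+m*n : ∀ m n → (m + n) C 2 ≡ m C 2 + n C 2 + m * n
  [m+n]C2≡mC2+nC2+m*n zero n = ≡.sym (+-identityʳ (n C 2))
  [m+n]C2≡mC2+nC2+m*n (suc m) n = begin
    suc (m + n) C 2                 ≡⟨ [1+m]C2≡m+mC2 (m + n) ⟩
    m + n + (m + n) C 2             ≡⟨ cong (m + n +_) ([m+n]C2≡mC2+nC2+m*n m n) ⟩
    m + n + (m C 2 + n C 2 + m * n) ≡⟨ regroup m n (m C 2) (n C 2) ⟩
    (m + m C 2) + n C 2 + suc m * n ≡⟨ cong (λ a → a + n C 2 + suc m * n) ([1+m]C2≡m+mC2 m) ⟨
    suc m C 2 + n C 2 + suc m * n   ∎
    where
    open ≡.≡-Reasoning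
    regroup : ∀ m n a b → m + n + (a + b + m * n) ≡ (m + a) + b + suc m * n
    regroup = solve-∀

  n+2*nC2≡n*n : ∀ n → n + 2 * (n C 2) ≡ n * n
  n+2*nC2≡n*n zero = ≡.refl
  n+2*nC2≡n*n (suc n) = begin
    suc n + 2 * (suc n C 2)       ≡⟨ cong (λ a → suc n + 2 * a) ([1+m]C2≡m+mC2 n) ⟩
    suc n + 2 * (n + n C 2)       ≡⟨ regroup n (n C 2) ⟩
    suc n + n + (n + 2 * (n C 2)) ≡⟨ cong (suc n + n +_) (n+2*nC2≡n*n n) ⟩
    suc n + n + n * n             ≡⟨ expand n ⟨
    suc n * suc n                 ∎
    where
    open ≡.≡-Reasoning
    regroup : ∀ n a → suc n + 2 * (n + a) ≡ suc n + n + (n + 2 * a)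
    regroup = solve-∀
    expand : ∀ n → suc n * suc n ≡ suc n + n + n * n
    expand = solve-∀

  [2*n]C2≡n+2*[2*nC2] : ∀ n → (2 * n) C 2 ≡ n + 2 * (2 * (n C 2))
  [2*n]C2≡n+2*[2*nC2] n = begin
    (2 * n) C 2                       ≡⟨ cong (_C 2) (double n) ⟩
    (n + n) C 2                       ≡⟨ [m+n]C2≡mC2+nC2+m*n n n ⟩
    n C 2 + n C 2 + n * n             ≡⟨ cong (n C 2 + n C 2 +_) (n+2*nC2≡n*n n) ⟨
    n C 2 + n C 2 + (n + 2 * (n C 2)) ≡⟨ regroup n (n C 2) ⟩
    n + 2 * (2 * (n C 2))             ∎
    where
    open ≡.≡-Reasoning
    double : ∀ n → 2 * n ≡ n + n
    double = solve-∀
    regroup : ∀ n a → a + a + (n + 2 * a) ≡ n + 2 * (2 * a)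
    regroup = solve-∀

  [2*n+1]C2≡n+2*[2*nC2+n] : ∀ n → (2 * n + 1) C 2 ≡ n + 2 * (2 * (n C 2) + n)
  [2*n+1]C2≡n+2*[2*nC2+n] n = begin
    (2 * n + 1) C 2                 ≡⟨ cong (_C 2) (+-comm (2 * n) 1) ⟩
    suc (2 * n) C 2                 ≡⟨ [1+m]C2≡m+mC2 (2 * n) ⟩
    2 * n + (2 * n) C 2             ≡⟨ cong (2 * n +_) ([2*n]C2≡n+2*[2*nC2] n) ⟩
    2 * n + (n + 2 * (2 * (n C 2))) ≡⟨ regroup n (n C 2) ⟩
    n + 2 * (2 * (n C 2) + n)       ∎
    where
    open ≡.≡-Reasoning
    regroup : ∀ n a → 2 * n + (n + 2 * (2 * a)) ≡ n + 2 * (2 * a + n)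
    regroup = solve-∀

  mC2+nC2+2*[m*n+nC2+n]≡[m+n]C2+[m+n]*n+n : ∀ m n →
    m C 2 + n C 2 + 2 * (m * n + n C 2 + n) ≡ (m + n) C 2 + (m + n) * n + n
  mC2+nC2+2*[m*n+nC2+n]≡[m+n]C2+[m+n]*n+n m n = begin
    m C 2 + n C 2 + 2 * (m * n + n C 2 + n)                   ≡⟨ regroup m n (m C 2) (n C 2) ⟩
    (m C 2 + n C 2 + m * n) + (m * n + (n + 2 * (n C 2))) + n
      ≡⟨ cong₂ (λ a b → a + (m * n + b) + n) (≡.sym ([m+n]C2≡mC2+nC2+m*n m n)) (n+2*nC2≡n*n n) ⟩
    (m + n) C 2 + (m * n + n * n) + n ≡⟨ cong (λ a → (m + n) C 2 + a + n) (*-distribʳ-+ n m n) ⟨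
    (m + n) C 2 + (m + n) * n + n     ∎
    where
    open ≡.≡-Reasoning
    regroup : ∀ m n a b → a + b + 2 * (m * n + b + n) ≡ (a + b + m * n) + (m * n + (n + 2 * b)) + n
    regroup = solve-∀

  mC2+nC2≡k+n[mod2] : ∀ m n k → m + n ≡ 2 * k → m C 2 + n C 2 ≡[mod2] k + n
  mC2+nC2≡k+n[mod2] m n k m+n≡2k = mod2 (m * n + n C 2 + n) (2 * (k C 2) + k * n) (begin
    m C 2 + n C 2 + 2 * (m * n + n C 2 + n) ≡⟨ mC2+nC2+2*[m*n+nC2+n]≡[m+n]C2+[m+n]*n+n m n ⟩
    (m + n) C 2 + (m + n) * n + n           ≡⟨ cong (λ a → a C 2 + a * n + n) m+n≡2k ⟩
    (2 * k) C 2 + 2 * k * n + n             ≡⟨ cong (λ a → a + 2 * k * n + n) ([2*n]C2≡n+2*[2*nC2] k) ⟩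
    k + 2 * (2 * (k C 2)) + 2 * k * n + n   ≡⟨ regroup k n (k C 2) ⟩
    k + n + 2 * (2 * (k C 2) + k * n)       ∎)
    where
    open ≡.≡-Reasoning
    regroup : ∀ k n a → k + 2 * (2 * a) + 2 * k * n + n ≡ k + n + 2 * (2 * a + k * n)
    regroup = solve-∀

  mC2+nC2≡k[mod2] : ∀ m n k → m + n ≡ 2 * k + 1 → m C 2 + n C 2 ≡[mod2] k
  mC2+nC2≡k[mod2] m n k m+n≡2k+1 = mod2 (m * n + n C 2 + n) (2 * (k C 2) + k + k * n + n) (begin
    m C 2 + n C 2 + 2 * (m * n + n C 2 + n)         ≡⟨ mC2+nC2+2*[m*n+nC2+n]≡[m+n]C2+[m+n]*n+n m n ⟩
    (m + n) C 2 + (m + n) * n + n                   ≡⟨ cong (λ a → a C 2 + a * n + n) m+n≡2k+1 ⟩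
    (2 * k + 1) C 2 + (2 * k + 1) * n + n           ≡⟨ cong (λ a → a + (2 * k + 1) * n + n) ([2*n+1]C2≡n+2*[2*nC2+n] k) ⟩
    k + 2 * (2 * (k C 2) + k) + (2 * k + 1) * n + n ≡⟨ regroup k n (k C 2) ⟩
    k + 2 * (2 * (k C 2) + k + k * n + n)           ∎)
    where
    open ≡.≡-Reasoning
    regroup : ∀ k n a → k + 2 * (2 * a + k) + (2 * k + 1) * n + n ≡ k + 2 * (2 * a + k + k * n + n)
    regroup = solve-∀

open Choose2 using (_≡[mod2]_; mod2; mC2+nC2≡k+n[mod2]; mC2+nC2≡k[mod2])
open import Data.Nat using (_∸_)
open import Data.Nat.Properties using (*-suc; m∸n+n≡m; m≤n⇒m≤1+n; ≤-refl)
open import Data.Product using (_,_)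
open import Relation.Binary.PropositionalEquality as ≡ using (_≡_)

module _ {c ℓ} (F : Field c ℓ) where
  open Field F
  open FieldDefs F
  open import Relation.Binary.Reasoning.Setoid setoid
  open import Algebra.Properties.Ring ring using (-1*x≈-x; -‿involutive)
  open import Algebra.Solver.CommutativeMonoid *-commutativeMonoid using (solve; _⊜_; _⊕_)

  sign : ℕ → Carrier
  sign a = (- 1#) ^ a

  ^-homo-* : ∀ x m n → x ^ (m ℕ.+ n) ≈ x ^ m * x ^ n
  ^-homo-* x ℕ.zero  n = sym (*-identityˡ _)
  ^-homo-* x (suc m) n = trans (*-congˡ (^-homo-* x m n)) (sym (*-assoc _ _ _))

  -‿^ : ∀ x n → (- x) ^ n ≈ sign n * x ^ n
  -‿^ x ℕ.zero  = sym (*-identityˡ 1#)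
  -‿^ x (suc n) = begin
    - x * (- x) ^ n               ≈⟨ *-cong (sym (-1*x≈-x x)) (-‿^ x n) ⟩
    (- 1# * x) * (sign n * x ^ n) ≈⟨ interchange (- 1#) x (sign n) (x ^ n) ⟩
    (- 1# * sign n) * (x * x ^ n) ∎
    where
    interchange : ∀ a x b y → (a * x) * (b * y) ≈ (a * b) * (x * y)
    interchange = solve 4 (λ a x b y → (a ⊕ x) ⊕ (b ⊕ y) ⊜ (a ⊕ b) ⊕ (x ⊕ y)) refl

  sign-2* : ∀ p → sign (2 ℕ.* p) ≈ 1#
  sign-2* ℕ.zero  = refl
  sign-2* (suc p) = begin
    sign (2 ℕ.* suc p)             ≡⟨ ≡.cong sign (*-suc 2 p) ⟩
    - 1# * (- 1# * sign (2 ℕ.* p)) ≈⟨ *-assoc _ _ _ ⟨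
    (- 1# * - 1#) * sign (2 ℕ.* p) ≈⟨ *-cong (trans (-1*x≈-x (- 1#)) (-‿involutive 1#)) (sign-2* p) ⟩
    1# * 1#                        ≈⟨ *-identityˡ 1# ⟩
    1#                             ∎

  sign-+2* : ∀ a p → sign (a ℕ.+ 2 ℕ.* p) ≈ sign a
  sign-+2* a p = trans (^-homo-* (- 1#) a _) (trans (*-congˡ (sign-2* p)) (*-identityʳ _))

  sign-cong-mod2 : ∀ {a b} → a ≡[mod2] b → sign a ≈ sign b
  sign-cong-mod2 {a} {b} (mod2 p q eq) = begin
    sign a                 ≈⟨ sign-+2* a p ⟨
    sign (a ℕ.+ 2 ℕ.* p)   ≡⟨ ≡.cong sign eq ⟩
    sign (b ℕ.+ 2 ℕ.* q)   ≈⟨ sign-+2* b q ⟩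
    sign b                 ∎

  sign-choose2-even : ∀ m n k → m ℕ.+ n ≡ 2 ℕ.* k →
                      sign (choose2 m) * sign (choose2 n) ≈ sign k * sign n
  sign-choose2-even m n k m+n≡2k = begin
    sign (choose2 m) * sign (choose2 n) ≈⟨ ^-homo-* (- 1#) (choose2 m) (choose2 n) ⟨
    sign (choose2 m ℕ.+ choose2 n)      ≈⟨ sign-cong-mod2 (mC2+nC2≡k+n[mod2] m n k m+n≡2k) ⟩
    sign (k ℕ.+ n)                      ≈⟨ ^-homo-* (- 1#) k n ⟩
    sign k * sign n                     ∎

  sign-choose2-odd : ∀ m n k → m ℕ.+ n ≡ 2 ℕ.* k ℕ.+ 1 →
                     sign (choose2 m) * sign (choose2 n) ≈ sign k
  sign-choose2-odd m n k m+n≡2k+1 = begin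
    sign (choose2 m) * sign (choose2 n) ≈⟨ ^-homo-* (- 1#) (choose2 m) (choose2 n) ⟨
    sign (choose2 m ℕ.+ choose2 n)      ≈⟨ sign-cong-mod2 (mC2+nC2≡k[mod2] m n k m+n≡2k+1) ⟩
    sign k                              ∎

  module _ (s t : Carrier) where
    open Lucas s t

    sumUpTo-cong : ∀ {f g} m → (∀ k → k ℕ.≤ m → f k ≈ g k) → sumUpTo f m ≈ sumUpTo g m
    sumUpTo-cong ℕ.zero  f≈g = f≈g 0 ℕ.z≤n
    sumUpTo-cong (suc m) f≈g =
      +-cong (sumUpTo-cong m (λ k k≤m → f≈g k (m≤n⇒m≤1+n k≤m))) (f≈g (suc m) ≤-refl)

    sumUpTo-*ˡ : ∀ a f m → sumUpTo (λ k → a * f k) m ≈ a * sumUpTo f m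
    sumUpTo-*ˡ a f ℕ.zero  = refl
    sumUpTo-*ˡ a f (suc m) = trans (+-congʳ (sumUpTo-*ˡ a f m)) (sym (distribˡ a _ _))

    term-negate-uv : ∀ u v x y N k →
      term (- u) (- v) x y N k ≈ (sign (choose2 (N ∸ k)) * sign (choose2 k)) * term u v x y N k
    term-negate-uv u v x y N k = begin
      L * ((- u) ^ i * ((- v) ^ j * X))               ≈⟨ *-congˡ (*-cong (-‿^ u i) (*-congʳ (-‿^ v j))) ⟩
      L * ((sign i * u ^ i) * ((sign j * v ^ j) * X)) ≈⟨ rearrange L (sign i) (u ^ i) (sign j) (v ^ j) X ⟩
      (sign i * sign j) * (L * (u ^ i * (v ^ j * X))) ∎
      where
      L X : Carrier
      L = lucasNomial N k
      X = x ^ (N ∸ k) * y ^ k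
      i j : ℕ
      i = choose2 (N ∸ k)
      j = choose2 k
      rearrange : ∀ l a p b q r → l * ((a * p) * ((b * q) * r)) ≈ (a * b) * (l * (p * (q * r)))
      rearrange = solve 6 (λ l a p b q r → l ⊕ ((a ⊕ p) ⊕ ((b ⊕ q) ⊕ r)) ⊜ (a ⊕ b) ⊕ (l ⊕ (p ⊕ (q ⊕ r)))) refl

    term-negate-y : ∀ u v x y N k → term u v x (- y) N k ≈ sign k * term u v x y N k
    term-negate-y u v x y N k = begin
      L * (U * (V * (X * (- y) ^ k)))          ≈⟨ *-congˡ (*-congˡ (*-congˡ (*-congˡ (-‿^ y k)))) ⟩
      L * (U * (V * (X * (sign k * y ^ k))))   ≈⟨ rearrange L U V X (sign k) (y ^ k) ⟩
      sign k * (L * (U * (V * (X * y ^ k))))   ∎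
      where
      L U V X : Carrier
      L = lucasNomial N k
      U = u ^ choose2 (N ∸ k)
      V = v ^ choose2 k
      X = x ^ (N ∸ k)
      rearrange : ∀ l p q r a z → l * (p * (q * (r * (a * z)))) ≈ a * (l * (p * (q * (r * z))))
      rearrange = solve 6 (λ l p q r a z → l ⊕ (p ⊕ (q ⊕ (r ⊕ (a ⊕ z)))) ⊜ a ⊕ (l ⊕ (p ⊕ (q ⊕ (r ⊕ z))))) refl

    oplus-negate-even : ∀ u v x y n →
      oplus (- u) (- v) x y (2 ℕ.* n) ≈ sign n * ominus u v x y (2 ℕ.* n)
    oplus-negate-even u v x y n = trans (sumUpTo-cong N termwise) (sumUpTo-*ˡ (sign n) _ N)
      where
      N = 2 ℕ.* n
      termwise : ∀ k → k ℕ.≤ N → term (- u) (- v) x y N k ≈ sign n * term u v x (- y) N k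
      termwise k k≤N = begin
        term (- u) (- v) x y N k
          ≈⟨ term-negate-uv u v x y N k ⟩
        (sign (choose2 (N ∸ k)) * sign (choose2 k)) * term u v x y N k
          ≈⟨ *-congʳ (sign-choose2-even (N ∸ k) k n (m∸n+n≡m k≤N)) ⟩
        (sign n * sign k) * term u v x y N k
          ≈⟨ *-assoc _ _ _ ⟩
        sign n * (sign k * term u v x y N k)
          ≈⟨ *-congˡ (term-negate-y u v x y N k) ⟨
        sign n * term u v x (- y) N k
          ∎

    oplus-negate-odd : ∀ u v x y n →
      oplus (- u) (- v) x y (2 ℕ.* n ℕ.+ 1) ≈ sign n * oplus u v x y (2 ℕ.* n ℕ.+ 1)
    oplus-negate-odd u v x y n = trans (sumUpTo-cong N termwise) (sumUpTo-*ˡ (sign n) _ N)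
      where
      N = 2 ℕ.* n ℕ.+ 1
      termwise : ∀ k → k ℕ.≤ N → term (- u) (- v) x y N k ≈ sign n * term u v x y N k
      termwise k k≤N =
        trans (term-negate-uv u v x y N k) (*-congʳ (sign-choose2-odd (N ∸ k) k n (m∸n+n≡m k≤N)))

-- The nonvanishing hypotheses only make the Lucas-nomials meaningful; the identities hold for any values of them.
mainTheorem1 : ∀ {c ℓ : Level} (F : Field c ℓ) →
    let open Field F
        open FieldDefs F
    in (s t : Carrier) → ¬ (s ≈ 0#) → ¬ (t ≈ 0#) →
       (∀ (n : ℕ) → ¬ (Lucas.lucas s t (suc n) ≈ 0#)) →
       ∀ (x y u v : Carrier) (n : ℕ) →
         (Lucas.oplus s t (- u) (- v) x y (2 ℕ.* n)
            ≈ ((- 1#) ^ n) * Lucas.ominus s t u v x y (2 ℕ.* n))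
         × (Lucas.oplus s t (- u) (- v) x y (2 ℕ.* n ℕ.+ 1)
            ≈ ((- 1#) ^ n) * Lucas.oplus s t u v x y (2 ℕ.* n ℕ.+ 1))
mainTheorem1 F s t _ _ _ x y u v n = oplus-negate-even F s t u v x y n , oplus-negate-odd F s t u v x y n
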